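{- A dimer model $Q$ is path-consistent if and only if its universal cover dimer model $\widetilde Q$ is path-consistent.
   Context: A dimer model is a quiver with faces $Q=(Q_0,Q_1,Q_2)$, $Q_2=Q_2^{cc}\sqcup Q_2^{cl}$ a set of cycles (faces), such that every arrow lies in one face (boundary) or two faces (internal), each internal arrow lies in one face of $Q_2^{cc}$ and one of $Q_2^{cl}$, incidence graphs at vertices are connected, and each vertex has finitely many incident arrows. Gluing polygons gives a surface $S(Q)$ containing $Q$. The universal cover dimer model $\widetilde Q$ is the dimer model on the universal cover of $S(Q)$ whose vertices, arrows and faces are the lifts of those of $Q$. For internal $\alpha$, $R_\alpha^{cc},R_\alpha^{cl}$ are the paths from $h(\alpha)$ to $t(\alpha)$ around the two faces containing $\alpha$; $A_Q=\mathbb CQ/\langle R_\alpha^{cc}-R_\alpha^{cl}\rangle$. A path is minimal if no face-path (cycle going once around a face) can be factored out of its class in $A_Q$. $Q$ is path-consistent if for all vertices $v_1,v_2$ and homotopy classes $C$ (in $S(Q)$) of paths from $v_1$ to $v_2$ there is a minimal path $r\in C$, unique up to equivalence, such that every path in $C$ from $v_1$ to $v_2$ is equivalent to $r$ composed with a unique number $m\ge0$ of face-paths. -}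

module Defs where

open import Data.Nat using (ℕ; zero; suc; _+_)
open import Data.Nat.DivMod using (_%_; m%n<n)
open import Data.Fin using (Fin; toℕ; fromℕ<; cast)
open import Data.List using (List; []; _∷_; _++_; map; upTo)
open import Data.List.Membership.Propositional using (_∈_)
open import Data.Product using (Σ; Σ-syntax; ∃; ∃-syntax; _×_; _,_; proj₁; proj₂)
open import Data.Sum using (_⊎_; inj₁; inj₂) renaming (map to map⊎)
open import Relation.Binary.PropositionalEquality using (_≡_; cong; sym)
open import Relation.Binary.Construct.Closure.Equivalence using (EqClosure)
open import Relation.Nullary using (¬_)
open import Data.Empty using (⊥)
open import Function.Bundles using (_⇔_)

rotFin : ∀ {n} → Fin (suc n) → ℕ → Fin (suc n)
rotFin {n} i k = fromℕ< (m%n<n (toℕ i + k) (suc n))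

-- Raw face data: a set of faces F, each face f being a cycle of arrows
-- arr f 0, arr f 1, ..., arr f (size f)  (so it has  suc (size f)  arrows),
-- with  h (arr f i) ≡ t (arr f (i+1 mod …)).

module FaceData {Q1 Fcc Fcl : Set}
                (size : Fcc ⊎ Fcl → ℕ)
                (arr : (f : Fcc ⊎ Fcl) → Fin (suc (size f)) → Q1) where

  Pos : Set
  Pos = Σ (Fcc ⊎ Fcl) (λ f → Fin (suc (size f)))

  arrAt : Pos → Q1
  arrAt (f , i) = arr f i

  -- two positions are the same (compared without dependent equality)
  SamePos : Pos → Pos → Set
  SamePos (f , i) (g , j) = f ≡ g × toℕ i ≡ toℕ j

  IsBoundary : Q1 → Set
  IsBoundary α = Σ Pos λ o → arrAt o ≡ α × (∀ o' → arrAt o' ≡ α → SamePos o' o)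

  IsInternal : Q1 → Set
  IsInternal α =
    Σ Fcc λ f → Σ (Fin (suc (size (inj₁ f)))) λ i →
    Σ Fcl λ g → Σ (Fin (suc (size (inj₂ g)))) λ j →
      arr (inj₁ f) i ≡ α × arr (inj₂ g) j ≡ α ×
      (∀ o' → arrAt o' ≡ α → SamePos o' (inj₁ f , i) ⊎ SamePos o' (inj₂ g , j))

  -- adjacency in the incidence graph at a vertex v: a head-half-edge of a
  -- and a tail-half-edge of b are adjacent iff a b are consecutive arrows
  -- of some face (a = arr f i, b = arr f (i+1)); the relation is symmetrised
  -- by EqClosure where it is used.
  IncAdj : {Q0 : Set} {hd tl : Q1 → Q0} {v : Q0} →
           Σ Q1 (λ a → hd a ≡ v) ⊎ Σ Q1 (λ a → tl a ≡ v) →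
           Σ Q1 (λ a → hd a ≡ v) ⊎ Σ Q1 (λ a → tl a ≡ v) → Set
  IncAdj (inj₁ (a , _)) (inj₂ (b , _)) =
    Σ (Fcc ⊎ Fcl) λ f → Σ (Fin (suc (size f))) λ i →
      arr f i ≡ a × arr f (rotFin i 1) ≡ b
  IncAdj _ _ = ⊥

record DimerModel : Set₁ where
  field
    Q0  : Set
    Q1  : Set
    h   : Q1 → Q0
    t   : Q1 → Q0
    Fcc : Set
    Fcl : Set
    size : Fcc ⊎ Fcl → ℕ
    arr  : (f : Fcc ⊎ Fcl) → Fin (suc (size f)) → Q1
    cyclic : ∀ f i → h (arr f i) ≡ t (arr f (rotFin i 1))
    arrowKind : ∀ α → FaceData.IsBoundary size arr α ⊎ FaceData.IsInternal size arr α
    incidenceConnected : ∀ v →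
      let HalfEdge = Σ Q1 (λ a → h a ≡ v) ⊎ Σ Q1 (λ a → t a ≡ v)
      in ∀ (x y : HalfEdge) → EqClosure (FaceData.IncAdj size arr) x y
    locallyFinite : ∀ v → Σ (List Q1) λ L → ∀ a → (h a ≡ v ⊎ t a ≡ v) → a ∈ L

data Dir : Set where
  fw bw : Dir

module _ (Q : DimerModel) where
  open DimerModel Q

  IsPath : Q0 → Q0 → List Q1 → Set
  IsPath v w []       = v ≡ w
  IsPath v w (a ∷ as) = t a ≡ v × IsPath (h a) w as

  -- R(f , i): the path from h (arr f i) to t (arr f i) going around face f
  R : (f : Fcc ⊎ Fcl) → Fin (suc (size f)) → List Q1
  R f i = map (λ k → arr f (rotFin i (suc k))) (upTo (size f))

  facePath : (f : Fcc ⊎ Fcl) → Fin (suc (size f)) → List Q1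
  facePath f i = arr f i ∷ R f i

  -- one elementary application of a relation  R_α^cc = R_α^cl  inside a
  -- path from v to w.  (α = arr (inj₁ f) i = arr (inj₂ g) j is then an
  -- internal arrow with its cc-face f and cl-face g.)
  AStep : Q0 → Q0 → List Q1 → List Q1 → Set
  AStep v w x y =
    Σ Fcc λ f → Σ (Fin (suc (size (inj₁ f)))) λ i →
    Σ Fcl λ g → Σ (Fin (suc (size (inj₂ g)))) λ j →
    Σ (List Q1) λ as → Σ (List Q1) λ bs →
      arr (inj₁ f) i ≡ arr (inj₂ g) j ×
      IsPath v (h (arr (inj₁ f) i)) as ×
      IsPath (t (arr (inj₁ f) i)) w bs ×
      x ≡ as ++ R (inj₁ f) i ++ bs ×
      y ≡ as ++ R (inj₂ g) j ++ bs

  -- equivalence of paths from v to w: equality in A_Q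
  Equiv : Q0 → Q0 → List Q1 → List Q1 → Set
  Equiv v w = EqClosure (AStep v w)

  Minimal : Q0 → Q0 → List Q1 → Set
  Minimal v w r =
    ¬ (Σ (Fcc ⊎ Fcl) λ f → Σ (Fin (suc (size f))) λ i →
       Σ (List Q1) λ as → Σ (List Q1) λ bs →
         IsPath v (t (arr f i)) as × IsPath (t (arr f i)) w bs ×
         Equiv v w r (as ++ facePath f i ++ bs))

  ComposedWith : Q0 → Q0 → ℕ → List Q1 → List Q1 → Set
  ComposedWith v w zero    r p = Equiv v w r p
  ComposedWith v w (suc m) r p =
    Σ (Fcc ⊎ Fcl) λ f → Σ (Fin (suc (size f))) λ i →
    Σ (List Q1) λ as → Σ (List Q1) λ bs →
      IsPath v (t (arr f i)) as × IsPath (t (arr f i)) w bs ×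
      Equiv v w r (as ++ bs) ×
      ComposedWith v w m (as ++ facePath f i ++ bs) p

  IsWalk : Q0 → Q0 → List (Dir × Q1) → Set
  IsWalk v w []              = v ≡ w
  IsWalk v w ((fw , a) ∷ as) = t a ≡ v × IsWalk (h a) w as
  IsWalk v w ((bw , a) ∷ as) = h a ≡ v × IsWalk (t a) w as

  toWalk : List Q1 → List (Dir × Q1)
  toWalk = map (λ a → (fw , a))

  -- elementary null-homotopic closed walks at u: backtrackings and
  -- boundaries of faces (2-cells of S(Q))
  Elementary : Q0 → List (Dir × Q1) → Set
  Elementary u c =
      (Σ Q1 λ a → t a ≡ u × c ≡ (fw , a) ∷ (bw , a) ∷ [])
    ⊎ (Σ Q1 λ a → h a ≡ u × c ≡ (bw , a) ∷ (fw , a) ∷ [])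
    ⊎ (Σ (Fcc ⊎ Fcl) λ f → Σ (Fin (suc (size f))) λ i →
         t (arr f i) ≡ u × c ≡ toWalk (facePath f i))

  HStep : Q0 → Q0 → List (Dir × Q1) → List (Dir × Q1) → Set
  HStep v w x y =
    Σ Q0 λ u → Σ (List (Dir × Q1)) λ as → Σ (List (Dir × Q1)) λ bs →
    Σ (List (Dir × Q1)) λ c →
      IsWalk v u as × IsWalk u w bs × Elementary u c ×
      x ≡ as ++ bs × y ≡ as ++ c ++ bs

  WalkHomotopic : Q0 → Q0 → List (Dir × Q1) → List (Dir × Q1) → Set
  WalkHomotopic v w = EqClosure (HStep v w)

  Homotopic : Q0 → Q0 → List Q1 → List Q1 → Set
  Homotopic v w p q = WalkHomotopic v w (toWalk p) (toWalk q)

  -- path-consistency.  The homotopy class C is given by a path p₀ in it.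
  PathConsistent : Set
  PathConsistent =
    ∀ v₁ v₂ (p₀ : List Q1) → IsPath v₁ v₂ p₀ →
    Σ (List Q1) λ r →
      IsPath v₁ v₂ r × Homotopic v₁ v₂ r p₀ × Minimal v₁ v₂ r ×
      (∀ r' → IsPath v₁ v₂ r' → Homotopic v₁ v₂ r' p₀ → Minimal v₁ v₂ r' →
         Equiv v₁ v₂ r' r) ×
      (∀ p → IsPath v₁ v₂ p → Homotopic v₁ v₂ p p₀ →
         Σ ℕ λ m → ComposedWith v₁ v₂ m r p ×
           (∀ m' → ComposedWith v₁ v₂ m' r p → m' ≡ m))

record IsUniversalCover (Q~ Q : DimerModel) : Set where
  private
    module C = DimerModel Q~
    module B = DimerModel Q
  field
    π₀  : C.Q0 → B.Q0
    π₁  : C.Q1 → B.Q1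
    πcc : C.Fcc → B.Fcc
    πcl : C.Fcl → B.Fcl
  πF : C.Fcc ⊎ C.Fcl → B.Fcc ⊎ B.Fcl
  πF = map⊎ πcc πcl
  field
    h-comm : ∀ a → B.h (π₁ a) ≡ π₀ (C.h a)
    t-comm : ∀ a → B.t (π₁ a) ≡ π₀ (C.t a)
    size-comm : ∀ f → B.size (πF f) ≡ C.size f
    arr-comm : ∀ f i →
      B.arr (πF f) (cast (cong suc (sym (size-comm f))) i) ≡ π₁ (C.arr f i)
    -- π is a covering: at every vertex ṽ it is a bijection from the
    -- arrows with head (resp. tail) ṽ onto those with head (tail) π₀ ṽ ...
    heads-inj : ∀ a b → C.h a ≡ C.h b → π₁ a ≡ π₁ b → a ≡ b
    tails-inj : ∀ a b → C.t a ≡ C.t b → π₁ a ≡ π₁ b → a ≡ b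
    heads-surj : ∀ ṽ β → B.h β ≡ π₀ ṽ → Σ C.Q1 λ a → C.h a ≡ ṽ × π₁ a ≡ β
    tails-surj : ∀ ṽ β → B.t β ≡ π₀ ṽ → Σ C.Q1 λ a → C.t a ≡ ṽ × π₁ a ≡ β
    -- ... and from the face corners at ṽ onto the face corners at π₀ ṽ
    -- (a corner at v is a position (f , i) with h (arr f i) ≡ v)
    corners-inj : ∀ f i g j → C.h (C.arr f i) ≡ C.h (C.arr g j) →
      πF f ≡ πF g → toℕ i ≡ toℕ j → f ≡ g
    corners-surj : ∀ ṽ g j → B.h (B.arr g j) ≡ π₀ ṽ →
      Σ (C.Fcc ⊎ C.Fcl) λ f → Σ (Fin (suc (C.size f))) λ i →
        C.h (C.arr f i) ≡ ṽ × πF f ≡ g × toℕ i ≡ toℕ j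
    π₀-surj : ∀ v → Σ C.Q0 λ ṽ → π₀ ṽ ≡ v
    -- π induces a bijection on connected components (injectivity part;
    -- surjectivity is π₀-surj)
    components : ∀ ṽ w̃ (c : List (Dir × B.Q1)) → IsWalk Q (π₀ ṽ) (π₀ w̃) c →
      Σ (List (Dir × C.Q1)) λ c̃ → IsWalk Q~ ṽ w̃ c̃
    simplyConnected : ∀ ṽ (c : List (Dir × C.Q1)) → IsWalk Q~ ṽ ṽ c →
      WalkHomotopic Q~ ṽ ṽ c []

-- A covering map π : Q~ → Q is bijective on the arrows leaving (and
-- entering) each vertex and on the face corners at each vertex, so paths,
-- walks, relation steps R^cc ↔ R^cl and elementary homotopies of Q lift
-- uniquely to Q~ once a starting vertex is chosen, and they all project back.
-- Hence equivalence, minimality and "r composed with m face-paths" are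
-- reflected and preserved by π.  Since S(Q~) is simply connected, two paths
-- of Q~ are homotopic exactly when they have the same endpoints, and two
-- paths of Q from π ṽ are homotopic exactly when their lifts at ṽ end at the
-- same vertex.  A homotopy class of paths of Q is therefore the projection
-- of the set of all paths of Q~ between two fixed vertices, and
-- path-consistency transfers in both directions.
module Submission where

open import Defs
open import Function using (id; _∘_)
open import Function.Bundles using (_⇔_; mk⇔)
open import Data.Nat using (ℕ; zero; suc; _+_)
open import Data.Nat.Properties using (+-assoc; +-identityʳ; +-comm)
open import Data.Nat.DivMod using (_%_; m%n<n; %-distribˡ-+; m%n%n≡m%n; [m+n]%n≡m%n; m<n⇒m%n≡m)
open import Data.Fin using (Fin; toℕ; cast)
open import Data.Fin.Properties using (toℕ-fromℕ<; toℕ-injective; toℕ<n; cast-is-id; toℕ-cast)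
open import Data.List using (List; []; _∷_; _++_; map; upTo; applyUpTo)
open import Data.List.Properties using (map-applyUpTo; ++-assoc; ++-identityʳ; map-++; map-∘; map-cong; ∷-injectiveˡ; ∷-injectiveʳ)
open import Data.Product using (Σ; _×_; _,_; proj₂)
open import Data.Sum using (_⊎_; inj₁; inj₂)
open import Relation.Binary.PropositionalEquality
open import Relation.Binary.Construct.Closure.Equivalence as EqClosure using (EqClosure)
open import Relation.Binary.Construct.Closure.ReflexiveTransitive using (ε; _◅_; _◅◅_)
open import Relation.Binary.Construct.Closure.Symmetric using (fwd; bwd)

rotFin-toℕ : ∀ {n} (i : Fin (suc n)) k → toℕ (rotFin i k) ≡ (toℕ i + k) % suc n
rotFin-toℕ {n} i k = toℕ-fromℕ< (m%n<n (toℕ i + k) (suc n))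

rotFin-+ : ∀ {n} (i : Fin (suc n)) k l → rotFin (rotFin i k) l ≡ rotFin i (k + l)
rotFin-+ {n} i k l = toℕ-injective (begin
  toℕ (rotFin (rotFin i k) l)       ≡⟨ rotFin-toℕ (rotFin i k) l ⟩
  (toℕ (rotFin i k) + l) % N        ≡⟨ cong (λ z → (z + l) % N) (rotFin-toℕ i k) ⟩
  ((toℕ i + k) % N + l) % N         ≡⟨ %-distribˡ-+ ((toℕ i + k) % N) l N ⟩
  ((toℕ i + k) % N % N + l % N) % N ≡⟨ cong (λ z → (z + l % N) % N) (m%n%n≡m%n (toℕ i + k) N) ⟩
  ((toℕ i + k) % N + l % N) % N     ≡⟨ sym (%-distribˡ-+ (toℕ i + k) l N) ⟩
  (toℕ i + k + l) % N               ≡⟨ cong (_% N) (+-assoc (toℕ i) k l) ⟩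
  (toℕ i + (k + l)) % N             ≡⟨ sym (rotFin-toℕ i (k + l)) ⟩
  toℕ (rotFin i (k + l))            ∎)
  where open ≡-Reasoning
        N = suc n

rotFin-identity : ∀ {n} (i : Fin (suc n)) → rotFin i 0 ≡ i
rotFin-identity {n} i = toℕ-injective (trans (rotFin-toℕ i 0)
  (trans (cong (_% suc n) (+-identityʳ (toℕ i))) (m<n⇒m%n≡m (toℕ<n i))))

rotFin-period : ∀ {n} (i : Fin (suc n)) → rotFin i (suc n) ≡ i
rotFin-period {n} i = toℕ-injective (trans (rotFin-toℕ i (suc n))
  (trans ([m+n]%n≡m%n (toℕ i) (suc n)) (m<n⇒m%n≡m (toℕ<n i))))

cast-rotFin : ∀ {m n} (e : m ≡ n) (i : Fin (suc m)) k →
  cast (cong suc e) (rotFin i k) ≡ rotFin (cast (cong suc e) i) k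
cast-rotFin refl i k =
  trans (cast-is-id refl (rotFin i k)) (cong (λ z → rotFin z k) (sym (cast-is-id refl i)))

map-++-++ : ∀ {A B : Set} (f : A → B) as m bs {as′ m′ bs′} →
  map f as ≡ as′ → map f m ≡ m′ → map f bs ≡ bs′ →
  map f (as ++ m ++ bs) ≡ as′ ++ m′ ++ bs′
map-++-++ f as m bs refl refl refl =
  trans (map-++ f as (m ++ bs)) (cong (map f as ++_) (map-++ f m bs))

flipDir : Dir → Dir
flipDir fw = bw
flipDir bw = fw

module DimerPaths (D : DimerModel) where
  open DimerModel D

  -- Definitionally, Minimal D v w r ≡ ¬ FaceFactorisation v w r.
  FaceFactorisation : Q0 → Q0 → List Q1 → Set
  FaceFactorisation v w r =
    Σ (Fcc ⊎ Fcl) λ f → Σ (Fin (suc (size f))) λ i →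
    Σ (List Q1) λ as → Σ (List Q1) λ bs →
      IsPath D v (t (arr f i)) as × IsPath D (t (arr f i)) w bs ×
      Equiv D v w r (as ++ facePath D f i ++ bs)

  IsPath-resp : ∀ {v v′ w w′ p} → v ≡ v′ → w ≡ w′ → IsPath D v w p → IsPath D v′ w′ p
  IsPath-resp refl refl p = p

  IsPath-++ : ∀ {v u w} as {bs} → IsPath D v u as → IsPath D u w bs → IsPath D v w (as ++ bs)
  IsPath-++ []       refl     q = q
  IsPath-++ (a ∷ as) (e , p) q = e , IsPath-++ as p q

  IsPath-target : ∀ {v w₁ w₂} p → IsPath D v w₁ p → IsPath D v w₂ p → w₁ ≡ w₂
  IsPath-target []      e₁       e₂       = trans (sym e₁) e₂
  IsPath-target (a ∷ p) (_ , p₁) (_ , p₂) = IsPath-target p p₁ p₂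

  IsWalk-++ : ∀ {v u w} as {bs} → IsWalk D v u as → IsWalk D u w bs → IsWalk D v w (as ++ bs)
  IsWalk-++ []              refl    q = q
  IsWalk-++ ((fw , a) ∷ as) (e , p) q = e , IsWalk-++ as p q
  IsWalk-++ ((bw , a) ∷ as) (e , p) q = e , IsWalk-++ as p q

  IsWalk-target : ∀ {v w₁ w₂} p → IsWalk D v w₁ p → IsWalk D v w₂ p → w₁ ≡ w₂
  IsWalk-target []             e₁       e₂       = trans (sym e₁) e₂
  IsWalk-target ((fw , a) ∷ p) (_ , p₁) (_ , p₂) = IsWalk-target p p₁ p₂
  IsWalk-target ((bw , a) ∷ p) (_ , p₁) (_ , p₂) = IsWalk-target p p₁ p₂

  IsPath⇒IsWalk : ∀ {v w} p → IsPath D v w p → IsWalk D v w (toWalk D p)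
  IsPath⇒IsWalk []      e       = e
  IsPath⇒IsWalk (a ∷ p) (e , q) = e , IsPath⇒IsWalk p q

  consecutive-IsPath : (a : ℕ → Q1) → (∀ k → h (a k) ≡ t (a (suc k))) → ∀ n →
    IsPath D (h (a 0)) (h (a n)) (applyUpTo (a ∘ suc) n)
  consecutive-IsPath a chained zero    = refl
  consecutive-IsPath a chained (suc n) =
    sym (chained 0) , consecutive-IsPath (a ∘ suc) (chained ∘ suc) n

  R-IsPath : ∀ f i → IsPath D (h (arr f i)) (t (arr f i)) (R D f i)
  R-IsPath f i = IsPath-resp starts ends
      (subst (IsPath D _ _) (sym (map-applyUpTo id (a ∘ suc) (size f)))
             (consecutive-IsPath a chained (size f)))
    where
      a : ℕ → Q1
      a k = arr f (rotFin i k)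
      next : ∀ k → rotFin (rotFin i k) 1 ≡ rotFin i (suc k)
      next k = trans (rotFin-+ i k 1) (cong (rotFin i) (+-comm k 1))
      chained : ∀ k → h (a k) ≡ t (a (suc k))
      chained k = trans (cyclic f (rotFin i k)) (cong (t ∘ arr f) (next k))
      starts : h (a 0) ≡ h (arr f i)
      starts = cong (h ∘ arr f) (rotFin-identity i)
      ends : h (a (size f)) ≡ t (arr f i)
      ends = trans (chained (size f)) (cong (t ∘ arr f) (rotFin-period i))

  facePath-IsPath : ∀ f i → IsPath D (t (arr f i)) (t (arr f i)) (facePath D f i)
  facePath-IsPath f i = refl , R-IsPath f i

  HStep-extendʳ : ∀ {v u w x y} z → HStep D v u x y → IsWalk D u w z →
    HStep D v w (x ++ z) (y ++ z)
  HStep-extendʳ z (u′ , as , bs , c , wa , wb , el , refl , refl) wz =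
    u′ , as , bs ++ z , c , wa , IsWalk-++ bs wb wz , el , ++-assoc as bs z ,
    trans (++-assoc as (c ++ bs) z) (cong (as ++_) (++-assoc c bs z))

  HStep-extendˡ : ∀ {v u w x y} z → IsWalk D v u z → HStep D u w x y →
    HStep D v w (z ++ x) (z ++ y)
  HStep-extendˡ z wz (u′ , as , bs , c , wa , wb , el , refl , refl) =
    u′ , z ++ as , bs , c , IsWalk-++ z wz wa , wb , el ,
    sym (++-assoc z as bs) , sym (++-assoc z as (c ++ bs))

  WalkHomotopic-extendʳ : ∀ {v u w x y} z → WalkHomotopic D v u x y → IsWalk D u w z →
    WalkHomotopic D v w (x ++ z) (y ++ z)
  WalkHomotopic-extendʳ z xy wz = EqClosure.gmap (_++ z) (λ s → HStep-extendʳ z s wz) xy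

  WalkHomotopic-extendˡ : ∀ {v u w x y} z → IsWalk D v u z → WalkHomotopic D u w x y →
    WalkHomotopic D v w (z ++ x) (z ++ y)
  WalkHomotopic-extendˡ z wz xy = EqClosure.gmap (z ++_) (HStep-extendˡ z wz) xy

  reverseWalk : List (Dir × Q1) → List (Dir × Q1)
  reverseWalk []             = []
  reverseWalk ((d , a) ∷ xs) = reverseWalk xs ++ (flipDir d , a) ∷ []

  IsWalk-reverse : ∀ {v w} xs → IsWalk D v w xs → IsWalk D w v (reverseWalk xs)
  IsWalk-reverse []              refl    = refl
  IsWalk-reverse ((fw , a) ∷ xs) (e , p) = IsWalk-++ (reverseWalk xs) (IsWalk-reverse xs p) (refl , e)
  IsWalk-reverse ((bw , a) ∷ xs) (e , p) = IsWalk-++ (reverseWalk xs) (IsWalk-reverse xs p) (refl , e)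

  reverse-++-cancel : ∀ {u w} y → IsWalk D u w y → WalkHomotopic D w w [] (reverseWalk y ++ y)
  reverse-++-cancel []              refl    = ε
  reverse-++-cancel {w = w} ((fw , a) ∷ y) (e , p) =
    subst (WalkHomotopic D w w []) (sym (++-assoc (reverseWalk y) _ _))
      (reverse-++-cancel y p ◅◅ fwd backtrack ◅ ε)
    where
      backtrack : HStep D w w (reverseWalk y ++ y) (reverseWalk y ++ (bw , a) ∷ (fw , a) ∷ y)
      backtrack = h a , reverseWalk y , y , _ , IsWalk-reverse y p , p ,
                  inj₂ (inj₁ (a , refl , refl)) , refl , refl
  reverse-++-cancel {w = w} ((bw , a) ∷ y) (e , p) =
    subst (WalkHomotopic D w w []) (sym (++-assoc (reverseWalk y) _ _))
      (reverse-++-cancel y p ◅◅ fwd backtrack ◅ ε)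
    where
      backtrack : HStep D w w (reverseWalk y ++ y) (reverseWalk y ++ (fw , a) ∷ (bw , a) ∷ y)
      backtrack = t a , reverseWalk y , y , _ , IsWalk-reverse y p , p ,
                  inj₁ (a , refl , refl) , refl , refl

  simplyConnected⇒WalkHomotopic :
    (∀ v c → IsWalk D v v c → WalkHomotopic D v v c []) →
    ∀ {v w} x y → IsWalk D v w x → IsWalk D v w y → WalkHomotopic D v w x y
  simplyConnected⇒WalkHomotopic nullHomotopic {v} {w} x y wx wy =
    subst (WalkHomotopic D v w x) (sym (++-assoc x (reverseWalk y) y)) insertLoop ◅◅ contractLoop
    where
      insertLoop : WalkHomotopic D v w x (x ++ (reverseWalk y ++ y))
      insertLoop = subst (λ z → WalkHomotopic D v w z (x ++ (reverseWalk y ++ y))) (++-identityʳ x)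
                     (WalkHomotopic-extendˡ x wx (reverse-++-cancel y wy))
      contractLoop : WalkHomotopic D v w ((x ++ reverseWalk y) ++ y) y
      contractLoop = WalkHomotopic-extendʳ y
        (nullHomotopic v (x ++ reverseWalk y) (IsWalk-++ x wx (IsWalk-reverse y wy))) wy

open DimerPaths using (FaceFactorisation)

module Covering (Q Q~ : DimerModel) (cover : IsUniversalCover Q~ Q) where
  open IsUniversalCover cover
  private
    module C = DimerModel Q~
    module B = DimerModel Q
    module PC = DimerPaths Q~
    module PB = DimerPaths Q

  project : List C.Q1 → List B.Q1
  project = map π₁

  projectStep : Dir × C.Q1 → Dir × B.Q1
  projectStep (d , a) = d , π₁ a

  projectWalk : List (Dir × C.Q1) → List (Dir × B.Q1)
  projectWalk = map projectStep

  projectWalk-toWalk : ∀ p → projectWalk (toWalk Q~ p) ≡ toWalk Q (project p)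
  projectWalk-toWalk []      = refl
  projectWalk-toWalk (a ∷ p) = cong ((fw , π₁ a) ∷_) (projectWalk-toWalk p)

  πPos : ∀ f → Fin (suc (C.size f)) → Fin (suc (B.size (πF f)))
  πPos f = cast (cong suc (sym (size-comm f)))

  π-arr-rotFin : ∀ f i k → π₁ (C.arr f (rotFin i k)) ≡ B.arr (πF f) (rotFin (πPos f i) k)
  π-arr-rotFin f i k = trans (sym (arr-comm f (rotFin i k)))
    (cong (B.arr (πF f)) (cast-rotFin (sym (size-comm f)) i k))

  project-R : ∀ f i → project (R Q~ f i) ≡ R Q (πF f) (πPos f i)
  project-R f i = begin
    map π₁ (map (λ k → C.arr f (rotFin i (suc k))) (upTo (C.size f)))
      ≡⟨ sym (map-∘ (upTo (C.size f))) ⟩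
    map (λ k → π₁ (C.arr f (rotFin i (suc k)))) (upTo (C.size f))
      ≡⟨ map-cong (π-arr-rotFin f i ∘ suc) (upTo (C.size f)) ⟩
    map (λ k → B.arr (πF f) (rotFin (πPos f i) (suc k))) (upTo (C.size f))
      ≡⟨ cong (λ n → map (λ k → B.arr (πF f) (rotFin (πPos f i) (suc k))) (upTo n)) (sym (size-comm f)) ⟩
    R Q (πF f) (πPos f i) ∎
    where open ≡-Reasoning

  project-facePath : ∀ f i → project (facePath Q~ f i) ≡ facePath Q (πF f) (πPos f i)
  project-facePath f i = cong₂ _∷_ (sym (arr-comm f i)) (project-R f i)

  h-πPos : ∀ f i → B.h (B.arr (πF f) (πPos f i)) ≡ π₀ (C.h (C.arr f i))
  h-πPos f i = trans (cong B.h (arr-comm f i)) (h-comm _)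

  t-πPos : ∀ f i → B.t (B.arr (πF f) (πPos f i)) ≡ π₀ (C.t (C.arr f i))
  t-πPos f i = trans (cong B.t (arr-comm f i)) (t-comm _)

  IsPath-project : ∀ {v w} p → IsPath Q~ v w p → IsPath Q (π₀ v) (π₀ w) (project p)
  IsPath-project []      e       = cong π₀ e
  IsPath-project (a ∷ p) (e , q) = trans (t-comm a) (cong π₀ e) ,
    subst (λ z → IsPath Q z _ (project p)) (sym (h-comm a)) (IsPath-project p q)

  IsWalk-project : ∀ {v w} p → IsWalk Q~ v w p → IsWalk Q (π₀ v) (π₀ w) (projectWalk p)
  IsWalk-project []             e       = cong π₀ e
  IsWalk-project ((fw , a) ∷ p) (e , q) = trans (t-comm a) (cong π₀ e) ,
    subst (λ z → IsWalk Q z _ (projectWalk p)) (sym (h-comm a)) (IsWalk-project p q)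
  IsWalk-project ((bw , a) ∷ p) (e , q) = trans (h-comm a) (cong π₀ e) ,
    subst (λ z → IsWalk Q z _ (projectWalk p)) (sym (t-comm a)) (IsWalk-project p q)

  IsPath-project-into : ∀ {v} f i p → IsPath Q~ v (C.t (C.arr f i)) p →
    IsPath Q (π₀ v) (B.t (B.arr (πF f) (πPos f i))) (project p)
  IsPath-project-into f i p q = subst (λ z → IsPath Q _ z (project p)) (sym (t-πPos f i)) (IsPath-project p q)

  IsPath-project-from : ∀ {w} f i p → IsPath Q~ (C.t (C.arr f i)) w p →
    IsPath Q (B.t (B.arr (πF f) (πPos f i))) (π₀ w) (project p)
  IsPath-project-from f i p q = subst (λ z → IsPath Q z _ (project p)) (sym (t-πPos f i)) (IsPath-project p q)

  AStep-project : ∀ {v w x y} → AStep Q~ v w x y → AStep Q (π₀ v) (π₀ w) (project x) (project y)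
  AStep-project (f , i , g , j , as , bs , eα , pa , pb , refl , refl) =
    πcc f , πPos (inj₁ f) i , πcl g , πPos (inj₂ g) j , project as , project bs ,
    trans (arr-comm (inj₁ f) i) (trans (cong π₁ eα) (sym (arr-comm (inj₂ g) j))) ,
    subst (λ z → IsPath Q _ z (project as)) (sym (h-πPos (inj₁ f) i)) (IsPath-project as pa) ,
    IsPath-project-from (inj₁ f) i bs pb ,
    map-++-++ π₁ as _ bs refl (project-R (inj₁ f) i) refl ,
    map-++-++ π₁ as _ bs refl (project-R (inj₂ g) j) refl

  Equiv-project : ∀ {v w x y} → Equiv Q~ v w x y → Equiv Q (π₀ v) (π₀ w) (project x) (project y)
  Equiv-project = EqClosure.gmap project AStep-project

  Elementary-project : ∀ {u c} → Elementary Q~ u c → Elementary Q (π₀ u) (projectWalk c)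
  Elementary-project (inj₁ (a , e , refl)) = inj₁ (π₁ a , trans (t-comm a) (cong π₀ e) , refl)
  Elementary-project (inj₂ (inj₁ (a , e , refl))) =
    inj₂ (inj₁ (π₁ a , trans (h-comm a) (cong π₀ e) , refl))
  Elementary-project (inj₂ (inj₂ (f , i , e , refl))) =
    inj₂ (inj₂ (πF f , πPos f i , trans (t-πPos f i) (cong π₀ e) ,
      trans (projectWalk-toWalk (facePath Q~ f i)) (cong (toWalk Q) (project-facePath f i))))

  HStep-project : ∀ {v w x y} → HStep Q~ v w x y →
    HStep Q (π₀ v) (π₀ w) (projectWalk x) (projectWalk y)
  HStep-project (u , as , bs , c , wa , wb , el , refl , refl) =
    π₀ u , projectWalk as , projectWalk bs , projectWalk c ,
    IsWalk-project as wa , IsWalk-project bs wb , Elementary-project el ,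
    map-++ projectStep as bs , map-++-++ projectStep as c bs refl refl refl

  Homotopic-project : ∀ {v w p q} → Homotopic Q~ v w p q →
    Homotopic Q (π₀ v) (π₀ w) (project p) (project q)
  Homotopic-project {v} {w} {p} {q} pq =
    subst₂ (WalkHomotopic Q (π₀ v) (π₀ w)) (projectWalk-toWalk p) (projectWalk-toWalk q)
      (EqClosure.gmap projectWalk HStep-project pq)

  ComposedWith-project : ∀ {v w} m {r p} → ComposedWith Q~ v w m r p →
    ComposedWith Q (π₀ v) (π₀ w) m (project r) (project p)
  ComposedWith-project zero r≈p = Equiv-project r≈p
  ComposedWith-project {v} {w} (suc m) {r} {p} (f , i , as , bs , pa , pb , r≈ab , rest) =
    πF f , πPos f i , project as , project bs ,
    IsPath-project-into f i as pa , IsPath-project-from f i bs pb ,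
    subst (Equiv Q (π₀ v) (π₀ w) (project r)) (map-++ π₁ as bs) (Equiv-project r≈ab) ,
    subst (λ z → ComposedWith Q (π₀ v) (π₀ w) m z (project p))
      (map-++-++ π₁ as _ bs refl (project-facePath f i) refl) (ComposedWith-project m rest)

  FaceFactorisation-project : ∀ {v w r} → FaceFactorisation Q~ v w r →
    FaceFactorisation Q (π₀ v) (π₀ w) (project r)
  FaceFactorisation-project {v} {w} {r} (f , i , as , bs , pa , pb , r≈) =
    πF f , πPos f i , project as , project bs ,
    IsPath-project-into f i as pa , IsPath-project-from f i bs pb ,
    subst (Equiv Q (π₀ v) (π₀ w) (project r))
      (map-++-++ π₁ as _ bs refl (project-facePath f i) refl) (Equiv-project r≈)

  lift-path : ∀ ṽ {w} p → IsPath Q (π₀ ṽ) w p →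
    Σ (List C.Q1) λ p̃ → Σ C.Q0 λ w̃ → IsPath Q~ ṽ w̃ p̃ × project p̃ ≡ p × π₀ w̃ ≡ w
  lift-path ṽ []      e       = [] , ṽ , refl , refl , e
  lift-path ṽ (a ∷ p) (e , q) with tails-surj ṽ a e
  ... | ã , tã , πã with lift-path (C.h ã) p
                           (subst (λ z → IsPath Q z _ p) (trans (cong B.h (sym πã)) (h-comm ã)) q)
  ... | p̃ , w̃ , q̃ , ep , ew = ã ∷ p̃ , w̃ , (tã , q̃) , cong₂ _∷_ πã ep , ew

  lift-path-unique : ∀ {ṽ w₁ w₂} p₁ p₂ → IsPath Q~ ṽ w₁ p₁ → IsPath Q~ ṽ w₂ p₂ →
    project p₁ ≡ project p₂ → p₁ ≡ p₂ × w₁ ≡ w₂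
  lift-path-unique []       []       e₁        e₂        _  = refl , trans (sym e₁) e₂
  lift-path-unique (a ∷ p₁) (b ∷ p₂) (ea , q₁) (eb , q₂) eq
    with tails-inj a b (trans ea (sym eb)) (∷-injectiveˡ eq)
  ... | refl with lift-path-unique p₁ p₂ q₁ q₂ (∷-injectiveʳ eq)
  ... | refl , ew = refl , ew

  lift-path-split : ∀ {ṽ w̃} x̃ as bs → IsPath Q~ ṽ w̃ x̃ → project x̃ ≡ as ++ bs →
    Σ (List C.Q1) λ ãs → Σ (List C.Q1) λ b̃s → Σ C.Q0 λ ũ →
      x̃ ≡ ãs ++ b̃s × IsPath Q~ ṽ ũ ãs × project ãs ≡ as × IsPath Q~ ũ w̃ b̃s × project b̃s ≡ bs
  lift-path-split {ṽ} x̃ [] bs px e = [] , x̃ , ṽ , refl , refl , refl , px , e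
  lift-path-split (ã ∷ x̃) (a ∷ as) bs (e , px) eq with lift-path-split x̃ as bs px (∷-injectiveʳ eq)
  ... | ãs , b̃s , ũ , refl , pa , ea , pb , eb =
    ã ∷ ãs , b̃s , ũ , refl , (e , pa) , cong₂ _∷_ (∷-injectiveˡ eq) ea , pb , eb

  lift-walk-unique : ∀ {ṽ w₁ w₂} p₁ p₂ → IsWalk Q~ ṽ w₁ p₁ → IsWalk Q~ ṽ w₂ p₂ →
    projectWalk p₁ ≡ projectWalk p₂ → p₁ ≡ p₂ × w₁ ≡ w₂
  lift-walk-unique [] [] e₁ e₂ _ = refl , trans (sym e₁) e₂
  lift-walk-unique ((fw , a) ∷ p₁) ((fw , b) ∷ p₂) (ea , q₁) (eb , q₂) eq
    with tails-inj a b (trans ea (sym eb)) (cong proj₂ (∷-injectiveˡ eq))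
  ... | refl with lift-walk-unique p₁ p₂ q₁ q₂ (∷-injectiveʳ eq)
  ... | refl , ew = refl , ew
  lift-walk-unique ((bw , a) ∷ p₁) ((bw , b) ∷ p₂) (ea , q₁) (eb , q₂) eq
    with heads-inj a b (trans ea (sym eb)) (cong proj₂ (∷-injectiveˡ eq))
  ... | refl with lift-walk-unique p₁ p₂ q₁ q₂ (∷-injectiveʳ eq)
  ... | refl , ew = refl , ew
  lift-walk-unique ((fw , a) ∷ p₁) ((bw , b) ∷ p₂) _ _ ()
  lift-walk-unique ((bw , a) ∷ p₁) ((fw , b) ∷ p₂) _ _ ()

  lift-walk-split : ∀ {ṽ w̃} x̃ as bs → IsWalk Q~ ṽ w̃ x̃ → projectWalk x̃ ≡ as ++ bs →
    Σ (List (Dir × C.Q1)) λ ãs → Σ (List (Dir × C.Q1)) λ b̃s → Σ C.Q0 λ ũ →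
      x̃ ≡ ãs ++ b̃s × IsWalk Q~ ṽ ũ ãs × projectWalk ãs ≡ as ×
      IsWalk Q~ ũ w̃ b̃s × projectWalk b̃s ≡ bs
  lift-walk-split {ṽ} x̃ [] bs px e = [] , x̃ , ṽ , refl , refl , refl , px , e
  lift-walk-split ((fw , ã) ∷ x̃) (a ∷ as) bs (e , px) eq with lift-walk-split x̃ as bs px (∷-injectiveʳ eq)
  ... | ãs , b̃s , ũ , refl , pa , ea , pb , eb =
    (fw , ã) ∷ ãs , b̃s , ũ , refl , (e , pa) , cong₂ _∷_ (∷-injectiveˡ eq) ea , pb , eb
  lift-walk-split ((bw , ã) ∷ x̃) (a ∷ as) bs (e , px) eq with lift-walk-split x̃ as bs px (∷-injectiveʳ eq)
  ... | ãs , b̃s , ũ , refl , pa , ea , pb , eb =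
    (bw , ã) ∷ ãs , b̃s , ũ , refl , (e , pa) , cong₂ _∷_ (∷-injectiveˡ eq) ea , pb , eb

  lift-path-target : ∀ {ṽ ũ u} ãs {as} → IsPath Q~ ṽ ũ ãs → project ãs ≡ as →
    IsPath Q (π₀ ṽ) u as → u ≡ π₀ ũ
  lift-path-target ãs pã refl pa = PB.IsPath-target (project ãs) pa (IsPath-project ãs pã)

  lift-walk-target : ∀ {ṽ ũ u} ãs {as} → IsWalk Q~ ṽ ũ ãs → projectWalk ãs ≡ as →
    IsWalk Q (π₀ ṽ) u as → u ≡ π₀ ũ
  lift-walk-target ãs pã refl pa = PB.IsWalk-target (projectWalk ãs) pa (IsWalk-project ãs pã)

  lift-corner : ∀ ũ g j → B.h (B.arr g j) ≡ π₀ ũ →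
    Σ (C.Fcc ⊎ C.Fcl) λ f̃ → Σ (Fin (suc (C.size f̃))) λ ĩ →
      C.h (C.arr f̃ ĩ) ≡ ũ × πF f̃ ≡ g × π₁ (C.arr f̃ ĩ) ≡ B.arr g j × project (R Q~ f̃ ĩ) ≡ R Q g j
  lift-corner ũ g j e with corners-surj ũ g j e
  ... | f̃ , ĩ , hd , refl , sameIndex =
    f̃ , ĩ , hd , refl ,
    trans (sym (arr-comm f̃ ĩ)) (cong (B.arr g) samePos) ,
    trans (project-R f̃ ĩ) (cong (R Q g) samePos)
    where
      samePos : πPos f̃ ĩ ≡ j
      samePos = toℕ-injective (trans (toℕ-cast _ ĩ) sameIndex)

  lift-facePath : ∀ ũ g j → B.t (B.arr g j) ≡ π₀ ũ →
    Σ (C.Fcc ⊎ C.Fcl) λ f̃ → Σ (Fin (suc (C.size f̃))) λ ĩ →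
      C.t (C.arr f̃ ĩ) ≡ ũ × project (facePath Q~ f̃ ĩ) ≡ facePath Q g j
  lift-facePath ũ g j e with tails-surj ũ (B.arr g j) e
  ... | α̃ , tα , πα with lift-corner (C.h α̃) g j (trans (cong B.h (sym πα)) (h-comm α̃))
  ... | f̃ , ĩ , hd , _ , πa , πR with heads-inj (C.arr f̃ ĩ) α̃ hd (trans πa (sym πα))
  ... | refl = f̃ , ĩ , tα , cong₂ _∷_ πa πR

  lift-R-occurrence : ∀ {ṽ w̃} x̃ as bs F I → IsPath Q~ ṽ w̃ x̃ → project x̃ ≡ as ++ R Q F I ++ bs →
    IsPath Q (π₀ ṽ) (B.h (B.arr F I)) as →
    Σ (List C.Q1) λ ãs → Σ (List C.Q1) λ b̃s →
    Σ (C.Fcc ⊎ C.Fcl) λ F̃ → Σ (Fin (suc (C.size F̃))) λ Ĩ →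
      x̃ ≡ ãs ++ R Q~ F̃ Ĩ ++ b̃s × IsPath Q~ ṽ (C.h (C.arr F̃ Ĩ)) ãs × project ãs ≡ as ×
      IsPath Q~ (C.t (C.arr F̃ Ĩ)) w̃ b̃s × project b̃s ≡ bs × πF F̃ ≡ F × π₁ (C.arr F̃ Ĩ) ≡ B.arr F I
  lift-R-occurrence x̃ as bs F I px ex pas with lift-path-split x̃ as (R Q F I ++ bs) px ex
  ... | ãs , rest , ũ , refl , pa , ea , prest , erest with lift-path-split rest (R Q F I) bs prest erest
  ... | R̃ , b̃s , ũ′ , refl , pR , eR , pb , eb
    with lift-corner ũ F I (lift-path-target ãs pa ea pas)
  ... | F̃ , Ĩ , hd , pf , πa , πR
    with lift-path-unique R̃ (R Q~ F̃ Ĩ) pR (PC.IsPath-resp hd refl (PC.R-IsPath F̃ Ĩ)) (trans eR (sym πR))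
  ... | refl , eu′ = ãs , b̃s , F̃ , Ĩ , refl , subst (λ z → IsPath Q~ _ z ãs) (sym hd) pa , ea ,
                     subst (λ z → IsPath Q~ z _ b̃s) eu′ pb , eb , pf , πa

  lift-partner-face : ∀ F̃ Ĩ G J → B.arr G J ≡ π₁ (C.arr F̃ Ĩ) →
    Σ (C.Fcc ⊎ C.Fcl) λ G̃ → Σ (Fin (suc (C.size G̃))) λ J̃ →
      C.arr G̃ J̃ ≡ C.arr F̃ Ĩ × πF G̃ ≡ G × project (R Q~ G̃ J̃) ≡ R Q G J
  lift-partner-face F̃ Ĩ G J e with lift-corner (C.h (C.arr F̃ Ĩ)) G J (trans (cong B.h e) (h-comm _))
  ... | G̃ , J̃ , hd , pg , πa , πR =
    G̃ , J̃ , heads-inj (C.arr G̃ J̃) (C.arr F̃ Ĩ) hd (trans πa e) , pg , πR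

  AStep-lift : ∀ {ṽ w̃ w x y} x̃ → AStep Q (π₀ ṽ) w x y → IsPath Q~ ṽ w̃ x̃ → project x̃ ≡ x →
    Σ (List C.Q1) λ ỹ → IsPath Q~ ṽ w̃ ỹ × project ỹ ≡ y × AStep Q~ ṽ w̃ x̃ ỹ
  AStep-lift x̃ (f , i , g , j , as , bs , eα , pa , pb , refl , refl) px ex
    with lift-R-occurrence x̃ as bs (inj₁ f) i px ex pa
  ... | ãs , b̃s , inj₂ _ , Ĩ , _ , _ , _ , _ , _ , () , _
  ... | ãs , b̃s , inj₁ f̃ , Ĩ , refl , pã , eã , pb̃ , eb̃ , _ , πa
    with lift-partner-face (inj₁ f̃) Ĩ (inj₂ g) j (trans (sym eα) (sym πa))
  ... | inj₁ _ , J̃ , _ , () , _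
  ... | inj₂ g̃ , J̃ , eG , _ , πR =
    ãs ++ R Q~ (inj₂ g̃) J̃ ++ b̃s ,
    PC.IsPath-++ ãs pã (PC.IsPath-++ (R Q~ (inj₂ g̃) J̃)
      (PC.IsPath-resp (cong C.h eG) (cong C.t eG) (PC.R-IsPath (inj₂ g̃) J̃)) pb̃) ,
    map-++-++ π₁ ãs _ b̃s eã πR eb̃ ,
    (f̃ , Ĩ , g̃ , J̃ , ãs , b̃s , sym eG , pã , pb̃ , refl , refl)

  AStep⁻¹-lift : ∀ {ṽ w̃ w x y} x̃ → AStep Q (π₀ ṽ) w y x → IsPath Q~ ṽ w̃ x̃ → project x̃ ≡ x →
    Σ (List C.Q1) λ ỹ → IsPath Q~ ṽ w̃ ỹ × project ỹ ≡ y × AStep Q~ ṽ w̃ ỹ x̃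
  AStep⁻¹-lift {ṽ} {w̃} x̃ (f , i , g , j , as , bs , eα , pa , pb , refl , refl) px ex
    with lift-R-occurrence x̃ as bs (inj₂ g) j px ex (subst (λ z → IsPath Q _ (B.h z) as) eα pa)
  ... | ãs , b̃s , inj₁ _ , J̃ , _ , _ , _ , _ , _ , () , _
  ... | ãs , b̃s , inj₂ g̃ , J̃ , refl , pã , eã , pb̃ , eb̃ , _ , πa
    with lift-partner-face (inj₂ g̃) J̃ (inj₁ f) i (trans eα (sym πa))
  ... | inj₂ _ , Ĩ , _ , () , _
  ... | inj₁ f̃ , Ĩ , eF , _ , πR =
    ãs ++ R Q~ (inj₁ f̃) Ĩ ++ b̃s ,
    PC.IsPath-++ ãs pã′ (PC.IsPath-++ (R Q~ (inj₁ f̃) Ĩ) (PC.R-IsPath (inj₁ f̃) Ĩ) pb̃′) ,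
    map-++-++ π₁ ãs _ b̃s eã πR eb̃ ,
    (f̃ , Ĩ , g̃ , J̃ , ãs , b̃s , eF , pã′ , pb̃′ , refl , refl)
    where
      pã′ : IsPath Q~ ṽ (C.h (C.arr (inj₁ f̃) Ĩ)) ãs
      pã′ = subst (λ z → IsPath Q~ _ (C.h z) ãs) (sym eF) pã
      pb̃′ : IsPath Q~ (C.t (C.arr (inj₁ f̃) Ĩ)) w̃ b̃s
      pb̃′ = subst (λ z → IsPath Q~ (C.t z) _ b̃s) (sym eF) pb̃

  Equiv-lift : ∀ {ṽ w̃ w x y} x̃ → Equiv Q (π₀ ṽ) w x y → IsPath Q~ ṽ w̃ x̃ → project x̃ ≡ x →
    Σ (List C.Q1) λ ỹ → IsPath Q~ ṽ w̃ ỹ × project ỹ ≡ y × Equiv Q~ ṽ w̃ x̃ ỹ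
  Equiv-lift x̃ ε px ex = x̃ , px , ex , ε
  Equiv-lift x̃ (fwd s ◅ rest) px ex with AStep-lift x̃ s px ex
  ... | z̃ , pz , ez , s̃ with Equiv-lift z̃ rest pz ez
  ... | ỹ , py , ey , rest̃ = ỹ , py , ey , fwd s̃ ◅ rest̃
  Equiv-lift x̃ (bwd s ◅ rest) px ex with AStep⁻¹-lift x̃ s px ex
  ... | z̃ , pz , ez , s̃ with Equiv-lift z̃ rest pz ez
  ... | ỹ , py , ey , rest̃ = ỹ , py , ey , bwd s̃ ◅ rest̃

  Equiv-reflect : ∀ {ṽ w̃ w} x̃ ỹ → IsPath Q~ ṽ w̃ x̃ → IsPath Q~ ṽ w̃ ỹ →
    Equiv Q (π₀ ṽ) w (project x̃) (project ỹ) → Equiv Q~ ṽ w̃ x̃ ỹ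
  Equiv-reflect x̃ ỹ px py x≈y with Equiv-lift x̃ x≈y px refl
  ... | ỹ′ , py′ , ey′ , x̃≈ỹ′ with lift-path-unique ỹ′ ỹ py′ py ey′
  ... | refl , _ = x̃≈ỹ′

  ComposedWith-lift : ∀ {ṽ w̃ w} m {r p} r̃ p̃ → ComposedWith Q (π₀ ṽ) w m r p →
    IsPath Q~ ṽ w̃ r̃ → project r̃ ≡ r → IsPath Q~ ṽ w̃ p̃ → project p̃ ≡ p →
    ComposedWith Q~ ṽ w̃ m r̃ p̃
  ComposedWith-lift zero r̃ p̃ r≈p pr refl pp refl = Equiv-reflect r̃ p̃ pr pp r≈p
  ComposedWith-lift {ṽ} {w̃} (suc m) r̃ p̃ (f , i , as , bs , pa , pb , r≈ab , rest) pr er pp ep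
    with Equiv-lift r̃ r≈ab pr er
  ... | x̃ , px , ex , r̃≈x̃ with lift-path-split x̃ as bs px ex
  ... | ãs , b̃s , ũ , refl , pã , eã , pb̃ , eb̃ with lift-facePath ũ f i (lift-path-target ãs pã eã pa)
  ... | f̃ , ĩ , refl , πface =
    f̃ , ĩ , ãs , b̃s , pã , pb̃ , r̃≈x̃ ,
    ComposedWith-lift m (ãs ++ facePath Q~ f̃ ĩ ++ b̃s) p̃ rest
      (PC.IsPath-++ ãs pã (PC.IsPath-++ (facePath Q~ f̃ ĩ) (PC.facePath-IsPath f̃ ĩ) pb̃))
      (map-++-++ π₁ ãs _ b̃s eã πface eb̃) pp ep

  FaceFactorisation-lift : ∀ {ṽ w̃ w r} r̃ → FaceFactorisation Q (π₀ ṽ) w r →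
    IsPath Q~ ṽ w̃ r̃ → project r̃ ≡ r → FaceFactorisation Q~ ṽ w̃ r̃
  FaceFactorisation-lift r̃ (f , i , as , bs , pa , pb , r≈) pr er with Equiv-lift r̃ r≈ pr er
  ... | ỹ , py , ey , r̃≈ỹ with lift-path-split ỹ as (facePath Q f i ++ bs) py ey
  ... | ãs , rest , ũ , refl , pã , eã , prest , erest with lift-facePath ũ f i (lift-path-target ãs pã eã pa)
  ... | f̃ , ĩ , refl , πface with lift-path-split rest (facePath Q f i) bs prest erest
  ... | facẽ , b̃s , ũ′ , refl , pface , eface , pb̃ , eb̃
    with lift-path-unique facẽ (facePath Q~ f̃ ĩ) pface (PC.facePath-IsPath f̃ ĩ) (trans eface (sym πface))
  ... | refl , refl = f̃ , ĩ , ãs , b̃s , pã , pb̃ , r̃≈ỹ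

  Elementary-lift : ∀ ũ {u c} → π₀ ũ ≡ u → Elementary Q u c →
    Σ (List (Dir × C.Q1)) λ c̃ → IsWalk Q~ ũ ũ c̃ × projectWalk c̃ ≡ c
  Elementary-lift ũ eu (inj₁ (a , e , refl)) with tails-surj ũ a (trans e (sym eu))
  ... | ã , tã , refl = (fw , ã) ∷ (bw , ã) ∷ [] , (tã , refl , tã) , refl
  Elementary-lift ũ eu (inj₂ (inj₁ (a , e , refl))) with heads-surj ũ a (trans e (sym eu))
  ... | ã , hã , refl = (bw , ã) ∷ (fw , ã) ∷ [] , (hã , refl , hã) , refl
  Elementary-lift ũ eu (inj₂ (inj₂ (g , j , e , refl))) with lift-facePath ũ g j (trans e (sym eu))
  ... | f̃ , ĩ , refl , πface =
    toWalk Q~ (facePath Q~ f̃ ĩ) , PC.IsPath⇒IsWalk _ (PC.facePath-IsPath f̃ ĩ) ,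
    trans (projectWalk-toWalk _) (cong (toWalk Q) πface)

  HStep-lift : ∀ {ṽ w̃ w x y} x̃ → HStep Q (π₀ ṽ) w x y → IsWalk Q~ ṽ w̃ x̃ → projectWalk x̃ ≡ x →
    Σ (List (Dir × C.Q1)) λ ỹ → IsWalk Q~ ṽ w̃ ỹ × projectWalk ỹ ≡ y
  HStep-lift x̃ (u , as , bs , c , wa , wb , el , refl , refl) px ex with lift-walk-split x̃ as bs px ex
  ... | ãs , b̃s , ũ , refl , pã , eã , pb̃ , eb̃ with Elementary-lift ũ (sym (lift-walk-target ãs pã eã wa)) el
  ... | c̃ , pc , ec = ãs ++ c̃ ++ b̃s , PC.IsWalk-++ ãs pã (PC.IsWalk-++ c̃ pc pb̃) ,
                      map-++-++ projectStep ãs c̃ b̃s eã ec eb̃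

  HStep⁻¹-lift : ∀ {ṽ w̃ w x y} x̃ → HStep Q (π₀ ṽ) w y x → IsWalk Q~ ṽ w̃ x̃ → projectWalk x̃ ≡ x →
    Σ (List (Dir × C.Q1)) λ ỹ → IsWalk Q~ ṽ w̃ ỹ × projectWalk ỹ ≡ y
  HStep⁻¹-lift x̃ (u , as , bs , c , wa , wb , el , refl , refl) px ex with lift-walk-split x̃ as (c ++ bs) px ex
  ... | ãs , rest , ũ , refl , pã , eã , prest , erest with Elementary-lift ũ (sym (lift-walk-target ãs pã eã wa)) el
  ... | c̃ , pc , ec with lift-walk-split rest c bs prest erest
  ... | c̃′ , b̃s , ũ′ , refl , pc′ , ec′ , pb̃ , eb̃ with lift-walk-unique c̃′ c̃ pc′ pc (trans ec′ (sym ec))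
  ... | refl , refl = ãs ++ b̃s , PC.IsWalk-++ ãs pã pb̃ , trans (map-++ projectStep ãs b̃s) (cong₂ _++_ eã eb̃)

  WalkHomotopic-lift : ∀ {ṽ w̃ w x y} x̃ → WalkHomotopic Q (π₀ ṽ) w x y →
    IsWalk Q~ ṽ w̃ x̃ → projectWalk x̃ ≡ x →
    Σ (List (Dir × C.Q1)) λ ỹ → IsWalk Q~ ṽ w̃ ỹ × projectWalk ỹ ≡ y
  WalkHomotopic-lift x̃ ε px ex = x̃ , px , ex
  WalkHomotopic-lift x̃ (fwd s ◅ rest) px ex with HStep-lift x̃ s px ex
  ... | z̃ , pz , ez = WalkHomotopic-lift z̃ rest pz ez
  WalkHomotopic-lift x̃ (bwd s ◅ rest) px ex with HStep⁻¹-lift x̃ s px ex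
  ... | z̃ , pz , ez = WalkHomotopic-lift z̃ rest pz ez

  Minimal-project : ∀ {ṽ w̃} r̃ → IsPath Q~ ṽ w̃ r̃ → Minimal Q~ ṽ w̃ r̃ →
    Minimal Q (π₀ ṽ) (π₀ w̃) (project r̃)
  Minimal-project r̃ pr minimal factorisation = minimal (FaceFactorisation-lift r̃ factorisation pr refl)

  Minimal-reflect : ∀ {ṽ w̃} r̃ → Minimal Q (π₀ ṽ) (π₀ w̃) (project r̃) → Minimal Q~ ṽ w̃ r̃
  Minimal-reflect r̃ minimal factorisation = minimal (FaceFactorisation-project factorisation)

  Homotopic-cover : ∀ {ṽ w̃} p̃ q̃ → IsPath Q~ ṽ w̃ p̃ → IsPath Q~ ṽ w̃ q̃ → Homotopic Q~ ṽ w̃ p̃ q̃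
  Homotopic-cover p̃ q̃ pp pq = PC.simplyConnected⇒WalkHomotopic simplyConnected
    (toWalk Q~ p̃) (toWalk Q~ q̃) (PC.IsPath⇒IsWalk p̃ pp) (PC.IsPath⇒IsWalk q̃ pq)

  lift-homotopic : ∀ {ṽ w̃} p̃₀ → IsPath Q~ ṽ w̃ p̃₀ → ∀ p → IsPath Q (π₀ ṽ) (π₀ w̃) p →
    Homotopic Q (π₀ ṽ) (π₀ w̃) p (project p̃₀) →
    Σ (List C.Q1) λ p̃ → IsPath Q~ ṽ w̃ p̃ × project p̃ ≡ p
  -- the lift of p ends where the lift of project p̃₀, namely p̃₀, ends: homotopies lift
  lift-homotopic {ṽ} p̃₀ pp₀ p pp p≃p₀ with lift-path ṽ p pp
  ... | p̃ , w̃ , pp̃ , refl , _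
    with WalkHomotopic-lift (toWalk Q~ p̃) p≃p₀ (PC.IsPath⇒IsWalk p̃ pp̃) (projectWalk-toWalk p̃)
  ... | q̃ , pq̃ , eq̃ with lift-walk-unique q̃ (toWalk Q~ p̃₀) pq̃ (PC.IsPath⇒IsWalk p̃₀ pp₀)
                           (trans eq̃ (sym (projectWalk-toWalk p̃₀)))
  ... | _ , refl = p̃ , pp̃ , refl

  PathConsistent-lift : PathConsistent Q → PathConsistent Q~
  PathConsistent-lift consistent ṽ₁ ṽ₂ p̃₀ pp̃₀
    with consistent (π₀ ṽ₁) (π₀ ṽ₂) (project p̃₀) (IsPath-project p̃₀ pp̃₀)
  ... | r , pr , r≃p₀ , minimal , unique , composed with lift-homotopic p̃₀ pp̃₀ r pr r≃p₀
  ... | r̃ , pr̃ , refl =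
    r̃ , pr̃ , Homotopic-cover r̃ p̃₀ pr̃ pp̃₀ , Minimal-reflect r̃ minimal , uniquẽ , composed̃
    where
      inClass : ∀ p̃ → IsPath Q~ ṽ₁ ṽ₂ p̃ → Homotopic Q (π₀ ṽ₁) (π₀ ṽ₂) (project p̃) (project p̃₀)
      inClass p̃ pp̃ = Homotopic-project (Homotopic-cover p̃ p̃₀ pp̃ pp̃₀)
      uniquẽ : ∀ r̃′ → IsPath Q~ ṽ₁ ṽ₂ r̃′ → Homotopic Q~ ṽ₁ ṽ₂ r̃′ p̃₀ → Minimal Q~ ṽ₁ ṽ₂ r̃′ →
        Equiv Q~ ṽ₁ ṽ₂ r̃′ r̃
      uniquẽ r̃′ pr̃′ _ minimal′ = Equiv-reflect r̃′ r̃ pr̃′ pr̃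
        (unique (project r̃′) (IsPath-project r̃′ pr̃′) (inClass r̃′ pr̃′) (Minimal-project r̃′ pr̃′ minimal′))
      composed̃ : ∀ p̃ → IsPath Q~ ṽ₁ ṽ₂ p̃ → Homotopic Q~ ṽ₁ ṽ₂ p̃ p̃₀ →
        Σ ℕ λ m → ComposedWith Q~ ṽ₁ ṽ₂ m r̃ p̃ × (∀ m′ → ComposedWith Q~ ṽ₁ ṽ₂ m′ r̃ p̃ → m′ ≡ m)
      composed̃ p̃ pp̃ _ with composed (project p̃) (IsPath-project p̃ pp̃) (inClass p̃ pp̃)
      ... | m , r∘m≈p , m-unique =
        m , ComposedWith-lift m r̃ p̃ r∘m≈p pr̃ refl pp̃ refl ,
        λ m′ r̃∘m′≈p̃ → m-unique m′ (ComposedWith-project m′ r̃∘m′≈p̃)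

  PathConsistent-descend : PathConsistent Q~ → PathConsistent Q
  PathConsistent-descend consistent v₁ v₂ p₀ pp₀ with π₀-surj v₁
  ... | ṽ₁ , refl with lift-path ṽ₁ p₀ pp₀
  ... | p̃₀ , ṽ₂ , pp̃₀ , refl , refl with consistent ṽ₁ ṽ₂ p̃₀ pp̃₀
  ... | r̃ , pr̃ , _ , minimal , unique , composed =
    project r̃ , IsPath-project r̃ pr̃ , Homotopic-project (Homotopic-cover r̃ p̃₀ pr̃ pp̃₀) ,
    Minimal-project r̃ pr̃ minimal , uniqueQ , composedQ
    where
      uniqueQ : ∀ r′ → IsPath Q (π₀ ṽ₁) (π₀ ṽ₂) r′ → Homotopic Q (π₀ ṽ₁) (π₀ ṽ₂) r′ (project p̃₀) →
        Minimal Q (π₀ ṽ₁) (π₀ ṽ₂) r′ → Equiv Q (π₀ ṽ₁) (π₀ ṽ₂) r′ (project r̃)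
      uniqueQ r′ pr′ r′≃p₀ minimal′ with lift-homotopic p̃₀ pp̃₀ r′ pr′ r′≃p₀
      ... | r̃′ , pr̃′ , refl = Equiv-project
        (unique r̃′ pr̃′ (Homotopic-cover r̃′ p̃₀ pr̃′ pp̃₀) (Minimal-reflect r̃′ minimal′))
      composedQ : ∀ p → IsPath Q (π₀ ṽ₁) (π₀ ṽ₂) p → Homotopic Q (π₀ ṽ₁) (π₀ ṽ₂) p (project p̃₀) →
        Σ ℕ λ m → ComposedWith Q (π₀ ṽ₁) (π₀ ṽ₂) m (project r̃) p ×
          (∀ m′ → ComposedWith Q (π₀ ṽ₁) (π₀ ṽ₂) m′ (project r̃) p → m′ ≡ m)
      composedQ p pp p≃p₀ with lift-homotopic p̃₀ pp̃₀ p pp p≃p₀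
      ... | p̃ , pp̃ , refl with composed p̃ pp̃ (Homotopic-cover p̃ p̃₀ pp̃ pp̃₀)
      ... | m , r̃∘m≈p̃ , m-unique =
        m , ComposedWith-project m r̃∘m≈p̃ ,
        λ m′ r∘m′≈p → m-unique m′ (ComposedWith-lift m′ r̃ p̃ r∘m′≈p pr̃ refl pp̃ refl)

proposition2p14 : (Q Q~ : DimerModel) → IsUniversalCover Q~ Q →
    (PathConsistent Q ⇔ PathConsistent Q~)
proposition2p14 Q Q~ cover = mk⇔ PathConsistent-lift PathConsistent-descend
  where open Covering Q Q~ cover
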